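{- Let $\ell$ be a prime and $0\le m\le n$ integers. Define the subgroups of $\mathrm{GL}_2(\mathbb{Z}_\ell)$ $$G_{m,n}=\left\{\begin{pmatrix}a&b\\c&d\end{pmatrix}\in\mathrm{GL}_2(\mathbb{Z}_\ell) : a-1\equiv c\equiv 0 \bmod \ell^m,\ b\equiv d-1\equiv 0\bmod \ell^n\right\},$$ $\Gamma=\mathrm{SL}_2(\mathbb{Z}_\ell)$ and $\Gamma_m=\{U\in\mathrm{GL}_2(\mathbb{Z}_\ell) : \det U\equiv 1\bmod \ell^m\}$. Then $G_{m,n}\cdot\Gamma=\Gamma_m$. -}

module Defs where

open import Data.Nat using (ℕ; suc; _^_)
open import Data.Integer using (ℤ; +_; _+_; _-_; _*_)
open import Data.Integer.Divisibility using (_∣_)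
open import Data.Product using (Σ; _×_; _,_; ∃; ∃-syntax)

-- ℓ-adic integers ℤ_ℓ = lim ℤ/ℓ^k, modelled as coherent sequences of integers
-- x = (x₀, x₁, …) with x_{k+1} ≡ x_k (mod ℓ^k); two such are equal in ℤ_ℓ
-- iff x_k ≡ y_k (mod ℓ^k) for all k.
Seq : Set
Seq = ℕ → ℤ

IsZl : ℕ → Seq → Set
IsZl ℓ x = ∀ k → (+ (ℓ ^ k)) ∣ (x (suc k) - x k)

_≈[_]_ : Seq → ℕ → Seq → Set
x ≈[ ℓ ] y = ∀ k → (+ (ℓ ^ k)) ∣ (x k - y k)

const : ℤ → Seq
const z _ = z

_⊕_ : Seq → Seq → Seq
(x ⊕ y) k = x k + y k

_⊖_ : Seq → Seq → Seq
(x ⊖ y) k = x k - y k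

_⊗_ : Seq → Seq → Seq
(x ⊗ y) k = x k * y k

CongMod : ℕ → ℕ → Seq → Seq → Set
CongMod ℓ m x y = ∃[ z ] (IsZl ℓ z × ((x ⊖ y) ≈[ ℓ ] (const (+ (ℓ ^ m)) ⊗ z)))

IsUnit : ℕ → Seq → Set
IsUnit ℓ x = ∃[ u ] (IsZl ℓ u × ((x ⊗ u) ≈[ ℓ ] const (+ 1)))

record Mat : Set where
  constructor mat
  field
    a b c d : Seq
open Mat public

IsMat : ℕ → Mat → Set
IsMat ℓ U = IsZl ℓ (a U) × IsZl ℓ (b U) × IsZl ℓ (c U) × IsZl ℓ (d U)

det : Mat → Seq
det U = (a U ⊗ d U) ⊖ (b U ⊗ c U)

_·_ : Mat → Mat → Mat
U · V = mat ((a U ⊗ a V) ⊕ (b U ⊗ c V)) ((a U ⊗ b V) ⊕ (b U ⊗ d V))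
            ((c U ⊗ a V) ⊕ (d U ⊗ c V)) ((c U ⊗ b V) ⊕ (d U ⊗ d V))

MatEq : ℕ → Mat → Mat → Set
MatEq ℓ U V = (a U ≈[ ℓ ] a V) × (b U ≈[ ℓ ] b V) × (c U ≈[ ℓ ] c V) × (d U ≈[ ℓ ] d V)

GL2 : ℕ → Mat → Set
GL2 ℓ U = IsMat ℓ U × IsUnit ℓ (det U)

SL2 : ℕ → Mat → Set
SL2 ℓ U = IsMat ℓ U × (det U ≈[ ℓ ] const (+ 1))

G : ℕ → ℕ → ℕ → Mat → Set
G ℓ m n U = GL2 ℓ U
  × CongMod ℓ m (a U) (const (+ 1)) × CongMod ℓ m (c U) (const (+ 0))
  × CongMod ℓ n (b U) (const (+ 0)) × CongMod ℓ n (d U) (const (+ 1))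

Γ : ℕ → ℕ → Mat → Set
Γ ℓ m U = GL2 ℓ U × CongMod ℓ m (det U) (const (+ 1))

InProduct : ℕ → ℕ → ℕ → Mat → Set
InProduct ℓ m n U = ∃[ g ] ∃[ γ ] (G ℓ m n g × SL2 ℓ γ × MatEq ℓ U (g · γ))

{-# OPTIONS --safe #-}
-- If det U ≡ 1 (mod ℓ^m), put D = det U and u = D⁻¹: then U = diag(D, 1) · γ, where γ is U with
-- its top row multiplied by u, so det γ = 1, and diag(D, 1) lies in G_{m,n} precisely because
-- D ≡ 1 (mod ℓ^m).  Conversely det(gγ) = det g = ad − bc ≡ 1·1 − b·0 = 1 (mod ℓ^m) for g ∈ G_{m,n},
-- as a ≡ 1, c ≡ 0 (mod ℓ^m) and d ≡ 1 (mod ℓ^n), hence (mod ℓ^m) since m ≤ n.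
module Submission where

open import Defs
open import Data.Nat using (ℕ; _≤_; _^_; _∸_; suc)
import Data.Nat as N
import Data.Nat.Properties as ℕ
import Data.Nat.Divisibility as ℕ∣
open import Data.Nat.Primality using (Prime)
open import Data.Product using (_×_; _,_)
open import Data.Integer using (ℤ; +_; -_; _+_; _-_; _*_)
open import Data.Integer.Divisibility using (_∣_)
import Data.Integer.Properties as ℤ
open import Data.Integer.Divisibility.Signed
  using (∣ᵤ⇒∣; ∣⇒∣ᵤ; ∣m∣n⇒∣m+n; ∣m⇒∣-m; ∣n⇒∣m*n; ∣m⇒∣m*n)
  renaming (_∣_ to _∣ₛ_)
open import Data.Integer.Tactic.RingSolver using (solve-∀)
open import Relation.Binary.Bundles using (Setoid)
open import Relation.Binary.PropositionalEquality
  using (_≡_; refl; sym; cong; subst; module ≡-Reasoning)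
import Relation.Binary.Reasoning.Setoid as SetoidReasoning

infix 4 _≡_[mod_]

_≡_[mod_] : ℤ → ℤ → ℤ → Set
x ≡ y [mod p ] = p ∣ (x - y)

module _ (p : ℤ) where

  private
    signed : ∀ x y → x ≡ y [mod p ] → p ∣ₛ (x - y)
    signed x y h = ∣ᵤ⇒∣ {i = x - y} h

  mod-reflexive : ∀ {x y} → x ≡ y → x ≡ y [mod p ]
  mod-reflexive {x} refl = subst (p ∣_) (sym (ℤ.+-inverseʳ x)) (_ ℕ∣.∣0)

  mod-sym : ∀ x y → x ≡ y [mod p ] → y ≡ x [mod p ]
  mod-sym x y h = ∣⇒∣ᵤ (subst (p ∣ₛ_) (lemma x y) (∣m⇒∣-m (signed x y h)))
    where
    lemma : ∀ x y → - (x - y) ≡ y - x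
    lemma = solve-∀

  mod-trans : ∀ x y z → x ≡ y [mod p ] → y ≡ z [mod p ] → x ≡ z [mod p ]
  mod-trans x y z h h′ =
    ∣⇒∣ᵤ (subst (p ∣ₛ_) (lemma x y z) (∣m∣n⇒∣m+n (signed x y h) (signed y z h′)))
    where
    lemma : ∀ x y z → (x - y) + (y - z) ≡ x - z
    lemma = solve-∀

  mod-add : ∀ x x′ y y′ → x ≡ x′ [mod p ] → y ≡ y′ [mod p ] → x + y ≡ x′ + y′ [mod p ]
  mod-add x x′ y y′ h h′ =
    ∣⇒∣ᵤ (subst (p ∣ₛ_) (lemma x x′ y y′) (∣m∣n⇒∣m+n (signed x x′ h) (signed y y′ h′)))
    where
    lemma : ∀ x x′ y y′ → (x - x′) + (y - y′) ≡ (x + y) - (x′ + y′)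
    lemma = solve-∀

  mod-sub : ∀ x x′ y y′ → x ≡ x′ [mod p ] → y ≡ y′ [mod p ] → x - y ≡ x′ - y′ [mod p ]
  mod-sub x x′ y y′ h h′ =
    ∣⇒∣ᵤ (subst (p ∣ₛ_) (lemma x x′ y y′) (∣m∣n⇒∣m+n (signed x x′ h) (∣m⇒∣-m (signed y y′ h′))))
    where
    lemma : ∀ x x′ y y′ → (x - x′) + - (y - y′) ≡ (x - y) - (x′ - y′)
    lemma = solve-∀

  mod-mul : ∀ x x′ y y′ → x ≡ x′ [mod p ] → y ≡ y′ [mod p ] → x * y ≡ x′ * y′ [mod p ]
  mod-mul x x′ y y′ h h′ =
    ∣⇒∣ᵤ (subst (p ∣ₛ_) (lemma x x′ y y′)
      (∣m∣n⇒∣m+n (∣m⇒∣m*n y (signed x x′ h)) (∣n⇒∣m*n x′ (signed y y′ h′))))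
    where
    lemma : ∀ x x′ y y′ → (x - x′) * y + x′ * (y - y′) ≡ x * y - x′ * y′
    lemma = solve-∀

+-^-split : ∀ ℓ {m n} → m ≤ n → + (ℓ ^ n) ≡ + (ℓ ^ m) * + (ℓ ^ (n ∸ m))
+-^-split ℓ {m} {n} m≤n = begin
  + (ℓ ^ n)                    ≡⟨ cong (λ e → + (ℓ ^ e)) (ℕ.m+[n∸m]≡n m≤n) ⟨
  + (ℓ ^ (m N.+ (n ∸ m)))      ≡⟨ cong +_ (ℕ.^-distribˡ-+-* ℓ m (n ∸ m)) ⟩
  + (ℓ ^ m N.* ℓ ^ (n ∸ m))    ≡⟨ ℤ.pos-* (ℓ ^ m) (ℓ ^ (n ∸ m)) ⟩
  + (ℓ ^ m) * + (ℓ ^ (n ∸ m))  ∎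
  where open ≡-Reasoning

module _ (ℓ : ℕ) where

  -- _≈[ ℓ ]_ wrapped in a record: Agda can recover the two sequences from a record type by
  -- unification, but not from the unfolded divisibility statement.
  infix 4 _≈_

  record _≈_ (x y : Seq) : Set where
    constructor mk≈
    field un≈ : x ≈[ ℓ ] y

  open _≈_

  ≈-reflexive : ∀ {x y} → (∀ k → x k ≡ y k) → x ≈ y
  ≈-reflexive eq = mk≈ λ k → mod-reflexive (+ (ℓ ^ k)) (eq k)

  ≈-refl : ∀ {x} → x ≈ x
  ≈-refl = ≈-reflexive (λ _ → refl)

  ≈-sym : ∀ {x y} → x ≈ y → y ≈ x
  ≈-sym {x} {y} (mk≈ h) = mk≈ λ k → mod-sym (+ (ℓ ^ k)) (x k) (y k) (h k)

  ≈-trans : ∀ {x y z} → x ≈ y → y ≈ z → x ≈ z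
  ≈-trans {x} {y} {z} (mk≈ h) (mk≈ h′) =
    mk≈ λ k → mod-trans (+ (ℓ ^ k)) (x k) (y k) (z k) (h k) (h′ k)

  ≈-setoid : Setoid _ _
  ≈-setoid = record
    { Carrier = Seq
    ; _≈_ = _≈_
    ; isEquivalence = record { refl = ≈-refl ; sym = ≈-sym ; trans = ≈-trans }
    }

  ⊕-cong : ∀ {x x′ y y′} → x ≈ x′ → y ≈ y′ → (x ⊕ y) ≈ (x′ ⊕ y′)
  ⊕-cong {x} {x′} {y} {y′} (mk≈ h) (mk≈ h′) =
    mk≈ λ k → mod-add (+ (ℓ ^ k)) (x k) (x′ k) (y k) (y′ k) (h k) (h′ k)

  ⊖-cong : ∀ {x x′ y y′} → x ≈ x′ → y ≈ y′ → (x ⊖ y) ≈ (x′ ⊖ y′)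
  ⊖-cong {x} {x′} {y} {y′} (mk≈ h) (mk≈ h′) =
    mk≈ λ k → mod-sub (+ (ℓ ^ k)) (x k) (x′ k) (y k) (y′ k) (h k) (h′ k)

  ⊗-cong : ∀ {x x′ y y′} → x ≈ x′ → y ≈ y′ → (x ⊗ y) ≈ (x′ ⊗ y′)
  ⊗-cong {x} {x′} {y} {y′} (mk≈ h) (mk≈ h′) =
    mk≈ λ k → mod-mul (+ (ℓ ^ k)) (x k) (x′ k) (y k) (y′ k) (h k) (h′ k)

  IsZl-const : ∀ z → IsZl ℓ (const z)
  IsZl-const z k = mod-reflexive (+ (ℓ ^ k)) {z} refl

  IsZl-⊕ : ∀ x y → IsZl ℓ x → IsZl ℓ y → IsZl ℓ (x ⊕ y)
  IsZl-⊕ x y hx hy k = mod-add (+ (ℓ ^ k)) (x (suc k)) (x k) (y (suc k)) (y k) (hx k) (hy k)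

  IsZl-⊖ : ∀ x y → IsZl ℓ x → IsZl ℓ y → IsZl ℓ (x ⊖ y)
  IsZl-⊖ x y hx hy k = mod-sub (+ (ℓ ^ k)) (x (suc k)) (x k) (y (suc k)) (y k) (hx k) (hy k)

  IsZl-⊗ : ∀ x y → IsZl ℓ x → IsZl ℓ y → IsZl ℓ (x ⊗ y)
  IsZl-⊗ x y hx hy k = mod-mul (+ (ℓ ^ k)) (x (suc k)) (x k) (y (suc k)) (y k) (hx k) (hy k)

  IsUnit-resp : ∀ {x y} → x ≈ y → IsUnit ℓ x → IsUnit ℓ y
  IsUnit-resp {x} {y} x≈y (u , zlu , xu≈1) =
    u , zlu , un≈ (≈-trans (⊗-cong (≈-sym x≈y) (≈-refl {u})) (mk≈ {x ⊗ u} xu≈1))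

  open SetoidReasoning ≈-setoid

  -- The record form of CongMod ℓ m, for the same reason.
  infix 4 _≡_[modℓ^_]

  record _≡_[modℓ^_] (x y : Seq) (m : ℕ) : Set where
    constructor mk≡
    field
      quotient      : Seq
      quotient-IsZl : IsZl ℓ quotient
      difference≈   : x ⊖ y ≈ const (+ (ℓ ^ m)) ⊗ quotient

  CongMod⇒≡ : ∀ {m x y} → CongMod ℓ m x y → x ≡ y [modℓ^ m ]
  CongMod⇒≡ (z , zlz , h) = mk≡ z zlz (mk≈ h)

  ≡⇒CongMod : ∀ {m x y} → x ≡ y [modℓ^ m ] → CongMod ℓ m x y
  ≡⇒CongMod (mk≡ z zlz h) = z , zlz , un≈ h

  module _ {m : ℕ} where

    private
      P : Seq
      P = const (+ (ℓ ^ m))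

    ≡-resp : ∀ {x x′ y y′} → x ≈ x′ → y ≈ y′ → x ≡ y [modℓ^ m ] → x′ ≡ y′ [modℓ^ m ]
    ≡-resp x≈x′ y≈y′ (mk≡ z zlz h) = mk≡ z zlz (≈-trans (⊖-cong (≈-sym x≈x′) (≈-sym y≈y′)) h)

    ≈⇒≡ : ∀ {x y} → x ≈ y → x ≡ y [modℓ^ m ]
    ≈⇒≡ {x} {y} x≈y = mk≡ (const (+ 0)) (IsZl-const (+ 0)) (begin
      x ⊖ y            ≈⟨ ⊖-cong x≈y (≈-refl {y}) ⟩
      y ⊖ y            ≈⟨ ≈-reflexive (λ k → lemma (y k) (P k)) ⟩
      P ⊗ const (+ 0)  ∎)
      where
      lemma : ∀ y p → y - y ≡ p * + 0
      lemma = solve-∀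

    ≡-⊖ : ∀ {x x′ y y′} → x ≡ x′ [modℓ^ m ] → y ≡ y′ [modℓ^ m ] → x ⊖ y ≡ x′ ⊖ y′ [modℓ^ m ]
    ≡-⊖ {x} {x′} {y} {y′} (mk≡ z zlz hx) (mk≡ w zlw hy) = mk≡ (z ⊖ w) (IsZl-⊖ z w zlz zlw) (begin
      (x ⊖ y) ⊖ (x′ ⊖ y′)  ≈⟨ ≈-reflexive (λ k → lemma₁ (x k) (x′ k) (y k) (y′ k)) ⟩
      (x ⊖ x′) ⊖ (y ⊖ y′)  ≈⟨ ⊖-cong hx hy ⟩
      (P ⊗ z) ⊖ (P ⊗ w)    ≈⟨ ≈-reflexive (λ k → lemma₂ (P k) (z k) (w k)) ⟩
      P ⊗ (z ⊖ w)          ∎)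
      where
      lemma₁ : ∀ x x′ y y′ → (x - y) - (x′ - y′) ≡ (x - x′) - (y - y′)
      lemma₁ = solve-∀
      lemma₂ : ∀ p z w → p * z - p * w ≡ p * (z - w)
      lemma₂ = solve-∀

    -- The quotient z y + x′ w must lie in ℤ_ℓ, hence the hypotheses on x′ and y.
    ≡-⊗ : ∀ {x x′ y y′} → IsZl ℓ x′ → IsZl ℓ y →
          x ≡ x′ [modℓ^ m ] → y ≡ y′ [modℓ^ m ] → x ⊗ y ≡ x′ ⊗ y′ [modℓ^ m ]
    ≡-⊗ {x} {x′} {y} {y′} zlx′ zly (mk≡ z zlz hx) (mk≡ w zlw hy) =
      mk≡ ((z ⊗ y) ⊕ (x′ ⊗ w))
          (IsZl-⊕ (z ⊗ y) (x′ ⊗ w) (IsZl-⊗ z y zlz zly) (IsZl-⊗ x′ w zlx′ zlw)) (begin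
        (x ⊗ y) ⊖ (x′ ⊗ y′)               ≈⟨ ≈-reflexive (λ k → lemma₁ (x k) (x′ k) (y k) (y′ k)) ⟩
        ((x ⊖ x′) ⊗ y) ⊕ (x′ ⊗ (y ⊖ y′))  ≈⟨ ⊕-cong (⊗-cong hx (≈-refl {y})) (⊗-cong (≈-refl {x′}) hy) ⟩
        ((P ⊗ z) ⊗ y) ⊕ (x′ ⊗ (P ⊗ w))    ≈⟨ ≈-reflexive (λ k → lemma₂ (P k) (z k) (y k) (x′ k) (w k)) ⟩
        P ⊗ ((z ⊗ y) ⊕ (x′ ⊗ w))          ∎)
      where
      lemma₁ : ∀ x x′ y y′ → x * y - x′ * y′ ≡ (x - x′) * y + x′ * (y - y′)
      lemma₁ = solve-∀
      lemma₂ : ∀ p z y x′ w → (p * z) * y + x′ * (p * w) ≡ p * (z * y + x′ * w)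
      lemma₂ = solve-∀

  CongMod-refl : ∀ m x → CongMod ℓ m x x
  CongMod-refl m x = ≡⇒CongMod (≈⇒≡ {m} (≈-refl {x}))

  ≡-weaken : ∀ {m n x y} → m ≤ n → x ≡ y [modℓ^ n ] → x ≡ y [modℓ^ m ]
  ≡-weaken {m} {n} {x} {y} m≤n (mk≡ z zlz h) =
    mk≡ (Q ⊗ z) (IsZl-⊗ Q z (IsZl-const (+ (ℓ ^ (n ∸ m)))) zlz) (begin
      x ⊖ y                        ≈⟨ h ⟩
      const (+ (ℓ ^ n)) ⊗ z        ≈⟨ ≈-reflexive (λ k → cong (_* z k) (+-^-split ℓ m≤n)) ⟩
      (const (+ (ℓ ^ m)) ⊗ Q) ⊗ z  ≈⟨ ≈-reflexive (λ k → ℤ.*-assoc (+ (ℓ ^ m)) (Q k) (z k)) ⟩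
      const (+ (ℓ ^ m)) ⊗ (Q ⊗ z)  ∎)
    where
    Q : Seq
    Q = const (+ (ℓ ^ (n ∸ m)))

  IsMat⇒IsZl-det : ∀ U → IsMat ℓ U → IsZl ℓ (det U)
  IsMat⇒IsZl-det U (za , zb , zc , zd) =
    IsZl-⊖ (a U ⊗ d U) (b U ⊗ c U) (IsZl-⊗ (a U) (d U) za zd) (IsZl-⊗ (b U) (c U) zb zc)

  det-cong : ∀ U V → MatEq ℓ U V → det U ≈ det V
  det-cong U V (ha , hb , hc , hd) =
    ⊖-cong (⊗-cong (mk≈ {a U} {a V} ha) (mk≈ {d U} {d V} hd))
           (⊗-cong (mk≈ {b U} {b V} hb) (mk≈ {c U} {c V} hc))

  det-· : ∀ U V → det (U · V) ≈ det U ⊗ det V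
  det-· U V = ≈-reflexive λ k → lemma (a U k) (b U k) (c U k) (d U k) (a V k) (b V k) (c V k) (d V k)
    where
    lemma : ∀ A B C D a b c d →
      (A * a + B * c) * (C * b + D * d) - (A * b + B * d) * (C * a + D * c)
        ≡ (A * D - B * C) * (a * d - b * c)
    lemma = solve-∀

  det≡1 : ∀ {m} U → IsMat ℓ U →
    a U ≡ const (+ 1) [modℓ^ m ] → c U ≡ const (+ 0) [modℓ^ m ] → d U ≡ const (+ 1) [modℓ^ m ] →
    det U ≡ const (+ 1) [modℓ^ m ]
  det≡1 U (_ , zb , zc , zd) a≡1 c≡0 d≡1 =
    ≡-resp ≈-refl (≈-reflexive λ k → lemma (b U k))
      (≡-⊖ (≡-⊗ (IsZl-const (+ 1)) zd a≡1 d≡1) (≡-⊗ zb zc (≈⇒≡ (≈-refl {b U})) c≡0))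
    where
    lemma : ∀ b → + 1 * + 1 - b * + 0 ≡ + 1
    lemma = solve-∀

  det≈det-left-factor : ∀ U g γ → SL2 ℓ γ → MatEq ℓ U (g · γ) → det U ≈ det g
  det≈det-left-factor U g γ (_ , detγ≈1) U≈gγ = begin
    det U                ≈⟨ det-cong U (g · γ) U≈gγ ⟩
    det (g · γ)          ≈⟨ det-· g γ ⟩
    det g ⊗ det γ        ≈⟨ ⊗-cong (≈-refl {det g}) (mk≈ detγ≈1) ⟩
    det g ⊗ const (+ 1)  ≈⟨ ≈-reflexive (λ k → ℤ.*-identityʳ (det g k)) ⟩
    det g                ∎

  InProduct⇒Γ : ∀ m n U → m ≤ n → IsMat ℓ U → InProduct ℓ m n U → Γ ℓ m U
  InProduct⇒Γ m n U m≤n matU (g , γ , ((matg , unitg) , a≡1 , c≡0 , _ , d≡1) , γ∈SL2 , U≈gγ) =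
    (matU , IsUnit-resp (≈-sym detU≈detg) unitg) ,
    ≡⇒CongMod (≡-resp (≈-sym detU≈detg) (≈-refl {const (+ 1)})
      (det≡1 g matg (CongMod⇒≡ a≡1) (CongMod⇒≡ c≡0) (≡-weaken m≤n (CongMod⇒≡ d≡1))))
    where
    detU≈detg : det U ≈ det g
    detU≈detg = det≈det-left-factor U g γ γ∈SL2 U≈gγ

  diag₁ : Seq → Mat
  diag₁ x = mat x (const (+ 0)) (const (+ 0)) (const (+ 1))

  scaleTopRow : Seq → Mat → Mat
  scaleTopRow u U = mat (u ⊗ a U) (u ⊗ b U) (c U) (d U)

  det-diag₁ : ∀ x → det (diag₁ x) ≈ x
  det-diag₁ x = ≈-reflexive λ k → lemma (x k)
    where
    lemma : ∀ x → x * + 1 - + 0 * + 0 ≡ x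
    lemma = solve-∀

  diag₁∈G : ∀ m n x → IsZl ℓ x → IsUnit ℓ x → CongMod ℓ m x (const (+ 1)) → G ℓ m n (diag₁ x)
  diag₁∈G m n x zlx unitx x≡1 =
    ((zlx , IsZl-const (+ 0) , IsZl-const (+ 0) , IsZl-const (+ 1)) ,
     IsUnit-resp (≈-sym (det-diag₁ x)) unitx) ,
    x≡1 , CongMod-refl m (const (+ 0)) , CongMod-refl n (const (+ 0)) , CongMod-refl n (const (+ 1))

  scaleTopRow∈SL2 : ∀ u U → IsZl ℓ u → IsMat ℓ U → (det U ⊗ u) ≈[ ℓ ] const (+ 1) →
                    SL2 ℓ (scaleTopRow u U)
  scaleTopRow∈SL2 u U zlu (za , zb , zc , zd) detU·u≈1 =
    (IsZl-⊗ u (a U) zlu za , IsZl-⊗ u (b U) zlu zb , zc , zd) ,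
    un≈ (≈-trans (≈-reflexive λ k → lemma (a U k) (b U k) (c U k) (d U k) (u k))
                 (mk≈ {det U ⊗ u} detU·u≈1))
    where
    lemma : ∀ a b c d u → (u * a) * d - (u * b) * c ≡ (a * d - b * c) * u
    lemma = solve-∀

  diag₁-·-scaleTopRow : ∀ x u U → (x ⊗ u) ≈[ ℓ ] const (+ 1) →
                        MatEq ℓ U (diag₁ x · scaleTopRow u U)
  diag₁-·-scaleTopRow x u U xu≈1 =
    un≈ (≈-sym (topRow (a U) (c U))) , un≈ (≈-sym (topRow (b U) (d U))) ,
    un≈ (≈-sym (bottomRow (c U) (a U))) , un≈ (≈-sym (bottomRow (d U) (b U)))
    where
    topRow : ∀ y z → (x ⊗ (u ⊗ y)) ⊕ (const (+ 0) ⊗ z) ≈ y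
    topRow y z = begin
      (x ⊗ (u ⊗ y)) ⊕ (const (+ 0) ⊗ z)  ≈⟨ ≈-reflexive (λ k → lemma₁ (x k) (u k) (y k) (z k)) ⟩
      (x ⊗ u) ⊗ y                        ≈⟨ ⊗-cong (mk≈ {x ⊗ u} xu≈1) (≈-refl {y}) ⟩
      const (+ 1) ⊗ y                    ≈⟨ ≈-reflexive (λ k → ℤ.*-identityˡ (y k)) ⟩
      y                                  ∎
      where
      lemma₁ : ∀ x u y z → x * (u * y) + + 0 * z ≡ (x * u) * y
      lemma₁ = solve-∀
    bottomRow : ∀ y z → (const (+ 0) ⊗ (u ⊗ z)) ⊕ (const (+ 1) ⊗ y) ≈ y
    bottomRow y z = ≈-reflexive λ k → lemma₂ (u k) (y k) (z k)
      where
      lemma₂ : ∀ u y z → + 0 * (u * z) + + 1 * y ≡ y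
      lemma₂ = solve-∀

  Γ⇒InProduct : ∀ m n U → IsMat ℓ U → Γ ℓ m U → InProduct ℓ m n U
  Γ⇒InProduct m n U matU ((_ , unit@(u , zlu , detU·u≈1)) , detU≡1) =
    diag₁ (det U) , scaleTopRow u U ,
    diag₁∈G m n (det U) (IsMat⇒IsZl-det U matU) unit detU≡1 ,
    scaleTopRow∈SL2 u U zlu matU detU·u≈1 ,
    diag₁-·-scaleTopRow (det U) u U detU·u≈1

mainTheorem14 : (ℓ : ℕ) → Prime ℓ → (m n : ℕ) → m ≤ n → (U : Mat) → IsMat ℓ U →
    (Γ ℓ m U → InProduct ℓ m n U) × (InProduct ℓ m n U → Γ ℓ m U)
mainTheorem14 ℓ _ m n m≤n U matU = Γ⇒InProduct ℓ m n U matU , InProduct⇒Γ ℓ m n U m≤n matU
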